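{- Let $\pi$ be a projective plane of order $q$ and let $n>1$ be a natural number. Then any embedding of $K_{s,t}$ into $\pi$, where $s\geq q-n$ and $t>n^2+n+1$, maps the class of size $t$ to points on a single line of $\pi$.
   Context: Graphs are finite, simple and undirected; $K_{s,t}$ is the complete bipartite graph with classes of sizes $s$ and $t$. An embedding of a graph $G=(V,E)$ into a projective plane $\pi=(\mathcal P,\mathcal L,\mathcal I)$ is an injective map $\phi:V\to\mathcal P$ such that the induced map $E\to\mathcal L$, sending an edge $ab$ to the unique line through $\phi(a)$ and $\phi(b)$, is injective. -}

module Defs where

open import Data.Nat using (ℕ; suc)
open import Data.Fin using (Fin)
open import Data.Sum using (_⊎_; inj₁; inj₂)
open import Data.Product using (Σ; ∃; _×_; _,_)
open import Function.Bundles using (_↔_)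
open import Function.Definitions using (Injective)
open import Relation.Binary.PropositionalEquality using (_≡_; _≢_)
open import Relation.Nullary using (¬_)

record ProjectivePlane : Set₁ where
  field
    Point : Set
    Line  : Set
    _I_   : Point → Line → Set
    I-prop : ∀ {p l} (a b : p I l) → a ≡ b
    two-points : ∀ p p' → p ≢ p' →
      Σ Line λ l → (p I l) × (p' I l) × (∀ l' → p I l' → p' I l' → l' ≡ l)
    two-lines : ∀ l l' → l ≢ l' →
      Σ Point λ p → (p I l) × (p I l') × (∀ p' → p' I l → p' I l' → p' ≡ p)
    quadrangle : Σ Point λ a → Σ Point λ b → Σ Point λ c → Σ Point λ d →
      (a ≢ b) × (a ≢ c) × (a ≢ d) × (b ≢ c) × (b ≢ d) × (c ≢ d) ×
      (∀ l → ¬ ((a I l) × (b I l) × (c I l))) ×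
      (∀ l → ¬ ((a I l) × (b I l) × (d I l))) ×
      (∀ l → ¬ ((a I l) × (c I l) × (d I l))) ×
      (∀ l → ¬ ((b I l) × (c I l) × (d I l)))

open ProjectivePlane public

HasOrder : ProjectivePlane → ℕ → Set
HasOrder π q = ∀ (l : Line π) → Fin (suc q) ↔ Σ (Point π) (λ p → _I_ π p l)

-- K_{s,t}: vertex set Fin s ⊎ Fin t (left class of size s, right class of
-- size t); edges are exactly the pairs (inj₁ i, inj₂ j), indexed by Fin s × Fin t.

-- An embedding of K_{s,t} into π: an injective map on vertices such that the
-- induced map edges → lines (edge ij ↦ the unique line through φ(i), φ(j)) is
-- injective; i.e. two edges whose endpoint-images lie on a common line are equal.
record Embedding (π : ProjectivePlane) (s t : ℕ) : Set where
  field
    φ       : Fin s ⊎ Fin t → Point π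
    φ-inj   : Injective _≡_ _≡_ φ
    edge-inj : ∀ (i i' : Fin s) (j j' : Fin t) (l : Line π) →
      _I_ π (φ (inj₁ i)) l → _I_ π (φ (inj₂ j)) l →
      _I_ π (φ (inj₁ i')) l → _I_ π (φ (inj₂ j')) l →
      (i , j) ≡ (i' , j')

-- Put a line l through two points b₀, b₁ of the right class and suppose some right
-- point z is off l. Every line through a left point meets the right class at most
-- once and contains no other left point, so the central projection from z onto l
-- sends the s left points to s distinct points of l carrying no right point: at most
-- q + 1 − s right points lie on l. Projecting from b₀ onto a line m through b₁ and z,
-- the right points off l land in the q − s points of m that are neither b₁ nor the
-- image of a left point; the same holds from b₁, and the two projections together
-- separate the right points off l, since two of them seen along one line from both b₀
-- and b₁ would lie on l. Hence t ≤ (q + 1 − s) + (q − s)² ≤ n² + n + 1, as q − s ≤ n.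
module Submission where

open import Defs
open import Data.Nat using (ℕ; zero; suc; _+_; _*_; _∸_; _≤_; _≥_; _>_; s≤s)
import Data.Nat.Properties as ℕ
open import Data.Fin using (Fin; zero; suc; join; splitAt; combine; punchOut; fromℕ<)
import Data.Fin.Properties as Fin
open import Data.Sum using (_⊎_; inj₁; inj₂; [_,_]′)
open import Data.Sum.Properties using (inj₁-injective; inj₂-injective)
open import Data.Product using (Σ; _×_; _,_; proj₁; proj₂)
open import Data.Empty using (⊥; ⊥-elim)
open import Function using (id; _∘_)
open import Function.Bundles using (Inverse)
open import Function.Definitions using (Injective)
open import Relation.Nullary using (¬_; Dec; yes; no)
open import Relation.Nullary.Decidable using (¬¬-excluded-middle)
open import Relation.Binary.PropositionalEquality
  using (_≡_; _≢_; refl; sym; trans; cong; subst; ≢-sym; module ≡-Reasoning)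

shrink-avoiding : ∀ {A : Set} N c (f : A → Fin N) (g : Fin c → Fin N) →
  Injective _≡_ _≡_ g → (∀ x i → f x ≢ g i) →
  Σ (A → Fin (N ∸ c)) λ f′ → ∀ x y → f′ x ≡ f′ y → f x ≡ f y
shrink-avoiding N zero f g _ _ = f , λ _ _ → id
shrink-avoiding zero (suc c) f g _ _ with g zero
... | ()
shrink-avoiding {A} (suc N) (suc c) f g g-inj f≢g =
  proj₁ rest , λ x y → Fin.punchOut-injective (g₀≢f x) (g₀≢f y) ∘ proj₂ rest x y
  where
  g₀≢f : ∀ x → g zero ≢ f x
  g₀≢f x = f≢g x zero ∘ sym
  g₀≢g : ∀ i → g zero ≢ g (suc i)
  g₀≢g i = Fin.0≢1+n ∘ g-inj
  rest : Σ (A → Fin (N ∸ c)) λ f′ → ∀ x y → f′ x ≡ f′ y → punchOut (g₀≢f x) ≡ punchOut (g₀≢f y)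
  rest = shrink-avoiding N c (λ x → punchOut (g₀≢f x)) (λ i → punchOut (g₀≢g i))
    (λ e → Fin.suc-injective (g-inj (Fin.punchOut-injective (g₀≢g _) (g₀≢g _) e)))
    (λ x i e → f≢g x (suc i) (Fin.punchOut-injective (g₀≢f x) (g₀≢g i) e))

injective-⊎⇒≤ : ∀ {t X Y} (h : Fin t → Fin X ⊎ Fin Y) → Injective _≡_ _≡_ h → t ≤ X + Y
injective-⊎⇒≤ {X = X} {Y} h h-inj = Fin.injective⇒≤ {f = join X Y ∘ h} (h-inj ∘ join-injective)
  where
  join-injective : ∀ {x y} → join X Y x ≡ join X Y y → x ≡ y
  join-injective {x} {y} e = begin
    x                        ≡⟨ sym (Fin.splitAt-join X Y x) ⟩
    splitAt X (join X Y x)   ≡⟨ cong (splitAt X) e ⟩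
    splitAt X (join X Y y)   ≡⟨ Fin.splitAt-join X Y y ⟩
    y                        ∎
    where open ≡-Reasoning

distinct-pair : ∀ {t} → 2 ≤ t → Σ (Fin t) λ j₀ → Σ (Fin t) λ j₁ → j₀ ≢ j₁
distinct-pair {suc (suc _)} _ = zero , suc zero , λ ()
distinct-pair {suc zero} (s≤s ())

¬¬-decidable : ∀ n (P : Fin n → Set) → ¬ ¬ (∀ j → Dec (P j))
¬¬-decidable zero P k = k λ ()
¬¬-decidable (suc n) P k = ¬¬-excluded-middle λ P₀? →
  ¬¬-decidable n (P ∘ suc) λ P? → k λ { zero → P₀? ; (suc j) → P? j }

count-bound : ∀ q n s → q ∸ n ≤ s → suc q ∸ s + (q ∸ s) * (q ∸ s) ≤ n * n + n + 1
count-bound q n s q∸n≤s = begin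
  suc q ∸ s + (q ∸ s) * (q ∸ s) ≤⟨ ℕ.+-mono-≤ suc-q∸s≤suc-n (ℕ.*-mono-≤ q∸s≤n q∸s≤n) ⟩
  suc n + n * n                 ≡⟨ ℕ.+-comm (suc n) (n * n) ⟩
  n * n + suc n                 ≡⟨ cong (n * n +_) (ℕ.+-comm 1 n) ⟩
  n * n + (n + 1)               ≡⟨ sym (ℕ.+-assoc (n * n) n 1) ⟩
  n * n + n + 1                 ∎
  where
  open ℕ.≤-Reasoning
  q≤s+n : q ≤ s + n
  q≤s+n = begin
    q           ≤⟨ ℕ.m≤n+m∸n q n ⟩
    n + (q ∸ n) ≤⟨ ℕ.+-monoʳ-≤ n q∸n≤s ⟩
    n + s       ≡⟨ ℕ.+-comm n s ⟩
    s + n       ∎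
  q∸s≤n : q ∸ s ≤ n
  q∸s≤n = ℕ.m≤n+o⇒m∸n≤o q s q≤s+n
  suc-q∸s≤suc-n : suc q ∸ s ≤ suc n
  suc-q∸s≤suc-n = ℕ.m≤n+o⇒m∸n≤o (suc q) s
    (ℕ.≤-trans (s≤s q≤s+n) (ℕ.≤-reflexive (sym (ℕ.+-suc s n))))

module Geometry (π : ProjectivePlane) (q : ℕ) (order : HasOrder π q) where

  _∈_ : Point π → Line π → Set
  p ∈ l = _I_ π p l

  index : ∀ {p l} → p ∈ l → Fin (suc q)
  index {p} {l} p∈l = Inverse.from (order l) (p , p∈l)

  index-injective : ∀ {p p′ l} (p∈l : p ∈ l) (p′∈l : p′ ∈ l) → index p∈l ≡ index p′∈l → p ≡ p′
  index-injective {l = l} p∈l p′∈l e = cong proj₁ (begin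
    (_ , p∈l)                         ≡⟨ sym (Inverse.strictlyInverseˡ (order l) _) ⟩
    Inverse.to (order l) (index p∈l)  ≡⟨ cong (Inverse.to (order l)) e ⟩
    Inverse.to (order l) (index p′∈l) ≡⟨ Inverse.strictlyInverseˡ (order l) _ ⟩
    (_ , p′∈l)                        ∎)
    where open ≡-Reasoning

  index-cong : ∀ {p p′ l} → p ≡ p′ → (p∈l : p ∈ l) (p′∈l : p′ ∈ l) → index p∈l ≡ index p′∈l
  index-cong refl p∈l p′∈l = cong index (I-prop π p∈l p′∈l)

  _≟-on_ : ∀ {p p′ l} → p ∈ l → p′ ∈ l → Dec (p ≡ p′)
  p∈l ≟-on p′∈l with index p∈l Fin.≟ index p′∈l
  ... | yes e = yes (index-injective p∈l p′∈l e)
  ... | no ne = no λ p≡p′ → ne (index-cong p≡p′ p∈l p′∈l)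

  ∈∉⇒≢ : ∀ {p p′ l} → p ∈ l → ¬ p′ ∈ l → p ≢ p′
  ∈∉⇒≢ p∈l p′∉l refl = p′∉l p∈l

  line : ∀ {p p′} → p ≢ p′ → Line π
  line p≢p′ = proj₁ (two-points π _ _ p≢p′)

  ∈-lineˡ : ∀ {p p′} (p≢p′ : p ≢ p′) → p ∈ line p≢p′
  ∈-lineˡ p≢p′ = proj₁ (proj₂ (two-points π _ _ p≢p′))

  ∈-lineʳ : ∀ {p p′} (p≢p′ : p ≢ p′) → p′ ∈ line p≢p′
  ∈-lineʳ p≢p′ = proj₁ (proj₂ (proj₂ (two-points π _ _ p≢p′)))

  line-unique : ∀ {p p′ l l′} → p ≢ p′ → p ∈ l → p′ ∈ l → p ∈ l′ → p′ ∈ l′ → l ≡ l′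
  line-unique {p} {p′} p≢p′ p∈l p′∈l p∈l′ p′∈l′ =
    trans (unique _ p∈l p′∈l) (sym (unique _ p∈l′ p′∈l′))
    where
    unique : ∀ l″ → p ∈ l″ → p′ ∈ l″ → l″ ≡ line p≢p′
    unique = proj₂ (proj₂ (proj₂ (two-points π _ _ p≢p′)))

  Collinear : Point π → Point π → Point π → Set
  Collinear x y z = Σ (Line π) λ l → x ∈ l × y ∈ l × z ∈ l

  collinear-swap : ∀ {x y z} → Collinear x y z → Collinear x z y
  collinear-swap (l , x∈l , y∈l , z∈l) = l , x∈l , z∈l , y∈l

  collinear⇒∈ : ∀ {x y z l} → x ≢ y → x ∈ l → y ∈ l → Collinear x y z → z ∈ l
  collinear⇒∈ x≢y x∈l y∈l (l′ , x∈l′ , y∈l′ , z∈l′) =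
    subst (_ ∈_) (line-unique x≢y x∈l′ y∈l′ x∈l y∈l) z∈l′

  collinear-from-two⇒∈ : ∀ {x y p p′ l} → x ≢ y → p ≢ p′ → x ∈ l → y ∈ l →
    Collinear x p p′ → Collinear y p p′ → p ∈ l
  collinear-from-two⇒∈ x≢y p≢p′ x∈l y∈l (M , x∈M , p∈M , p′∈M) (M′ , y∈M′ , p∈M′ , p′∈M′) =
    collinear⇒∈ x≢y x∈l y∈l (M , x∈M , subst (_ ∈_) M′≡M y∈M′ , p∈M)
    where
    M′≡M : M′ ≡ M
    M′≡M = line-unique p≢p′ p∈M′ p′∈M′ p∈M p′∈M

  module Projection {c : Point π} {m : Line π} (c∉m : ¬ c ∈ m) where

    module _ {p : Point π} (c≢p : c ≢ p) where

      private
        ray≢m : line c≢p ≢ m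
        ray≢m e = c∉m (subst (c ∈_) e (∈-lineˡ c≢p))

      foot : Point π
      foot = proj₁ (two-lines π (line c≢p) m ray≢m)

      foot∈ray : foot ∈ line c≢p
      foot∈ray = proj₁ (proj₂ (two-lines π (line c≢p) m ray≢m))

      foot∈m : foot ∈ m
      foot∈m = proj₁ (proj₂ (proj₂ (two-lines π (line c≢p) m ray≢m)))

      foot-unique : ∀ {x} → x ∈ line c≢p → x ∈ m → x ≡ foot
      foot-unique = proj₂ (proj₂ (proj₂ (two-lines π (line c≢p) m ray≢m))) _

      shadow : Fin (suc q)
      shadow = index foot∈m

    shadow-on : ∀ {p} (c≢p : c ≢ p) (p∈m : p ∈ m) → shadow c≢p ≡ index p∈m
    shadow-on c≢p p∈m = index-cong (sym (foot-unique c≢p (∈-lineʳ c≢p) p∈m)) (foot∈m c≢p) p∈m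

    shadow-≡⇒collinear : ∀ {p p′} (c≢p : c ≢ p) (c≢p′ : c ≢ p′) →
      shadow c≢p ≡ shadow c≢p′ → Collinear c p p′
    shadow-≡⇒collinear c≢p c≢p′ e =
      line c≢p , ∈-lineˡ c≢p , ∈-lineʳ c≢p , subst (_ ∈_) (sym rays) (∈-lineʳ c≢p′)
      where
      feet : foot c≢p ≡ foot c≢p′
      feet = index-injective (foot∈m c≢p) (foot∈m c≢p′) e
      rays : line c≢p ≡ line c≢p′
      rays = line-unique (≢-sym (∈∉⇒≢ (foot∈m c≢p) c∉m)) (∈-lineˡ c≢p) (foot∈ray c≢p)
        (∈-lineˡ c≢p′) (subst (_∈ line c≢p′) (sym feet) (foot∈ray c≢p′))

    ∈m? : ∀ {p} → c ≢ p → Dec (p ∈ m)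
    ∈m? c≢p with ∈-lineʳ c≢p ≟-on foot∈ray c≢p
    ... | yes p≡foot = yes (subst (_∈ m) (sym p≡foot) (foot∈m c≢p))
    ... | no p≢foot = no (p≢foot ∘ foot-unique c≢p (∈-lineʳ c≢p))

module Configuration {π : ProjectivePlane} {q : ℕ} (order : HasOrder π q) {s t : ℕ}
                     (e : Embedding π s t) where
  open Geometry π q order
  open Embedding e

  a : Fin s → Point π
  a i = φ (inj₁ i)

  b : Fin t → Point π
  b j = φ (inj₂ j)

  a≢b : ∀ i j → a i ≢ b j
  a≢b i j a≡b with φ-inj a≡b
  ... | ()

  b-injective : Injective _≡_ _≡_ b
  b-injective = inj₂-injective ∘ φ-inj

  collinear-bba⇒≡ : ∀ {j j′ i} → Collinear (b j) (b j′) (a i) → j ≡ j′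
  collinear-bba⇒≡ (l , bj∈l , bj′∈l , ai∈l) = cong proj₂ (edge-inj _ _ _ _ l ai∈l bj∈l ai∈l bj′∈l)

  collinear-baa⇒≡ : ∀ {j i i′} → Collinear (b j) (a i) (a i′) → i ≡ i′
  collinear-baa⇒≡ (l , bj∈l , ai∈l , ai′∈l) = cong proj₁ (edge-inj _ _ _ _ l ai∈l bj∈l ai′∈l bj∈l)

  module Through {j₀ j₁ : Fin t} (j₀≢j₁ : j₀ ≢ j₁) where

    l : Line π
    l = line (j₀≢j₁ ∘ b-injective)

    b₀∈l : b j₀ ∈ l
    b₀∈l = ∈-lineˡ (j₀≢j₁ ∘ b-injective)

    b₁∈l : b j₁ ∈ l
    b₁∈l = ∈-lineʳ (j₀≢j₁ ∘ b-injective)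

    a∉l : ∀ i → ¬ a i ∈ l
    a∉l i ai∈l = j₀≢j₁ (collinear-bba⇒≡ (l , b₀∈l , b₁∈l , ai∈l))

    ∈l? : Fin s → ∀ j → Dec (b j ∈ l)
    ∈l? i j = Projection.∈m? (a∉l i) (a≢b i j)

    all-on-l⇒t≤ : (∀ j → b j ∈ l) → t ≤ suc q
    all-on-l⇒t≤ on = Fin.injective⇒≤ {f = λ j → index (on j)}
      (b-injective ∘ index-injective (on _) (on _))

    off-l-separated : ∀ {j j′} → Dec (j ≡ j′) → ¬ b j ∈ l →
      Collinear (b j₀) (b j) (b j′) → Collinear (b j₁) (b j) (b j′) → j ≡ j′
    off-l-separated (yes j≡j′) _ _ _ = j≡j′
    off-l-separated (no j≢j′) bj∉l from₀ from₁ = ⊥-elim (bj∉l (collinear-from-two⇒∈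
      (j₀≢j₁ ∘ b-injective) (j≢j′ ∘ b-injective) b₀∈l b₁∈l from₀ from₁))

    module _ {k : Fin t} (bk∉l : ¬ b k ∈ l) (dec : ∀ j → Dec (b j ∈ l)) where

      OnL : Set
      OnL = Σ (Fin t) λ j → b j ∈ l

      OffL : Set
      OffL = Σ (Fin t) λ j → ¬ b j ∈ l

      on-code : Σ (OnL → Fin (suc q ∸ s)) λ f → ∀ x y → f x ≡ f y → proj₁ x ≡ proj₁ y
      on-code = proj₁ shrunk , λ x y → b-injective ∘ index-injective _ _ ∘ proj₂ shrunk x y
        where
        open Projection bk∉l
        bk≢a : ∀ i → b k ≢ a i
        bk≢a i = ≢-sym (a≢b i k)
        avoids : ∀ (x : OnL) i → index (proj₂ x) ≢ shadow (bk≢a i)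
        avoids (j , bj∈l) i e = bk∉l (subst (λ j → b j ∈ l) (sym k≡j) bj∈l)
          where
          bk≢bj : b k ≢ b j
          bk≢bj = ≢-sym (∈∉⇒≢ bj∈l bk∉l)
          k≡j : k ≡ j
          k≡j = collinear-bba⇒≡ (shadow-≡⇒collinear bk≢bj (bk≢a i)
                  (trans (shadow-on bk≢bj bj∈l) e))
        shrunk : Σ (OnL → Fin (suc q ∸ s)) λ f → ∀ x y → f x ≡ f y → index (proj₂ x) ≡ index (proj₂ y)
        shrunk = shrink-avoiding (suc q) s (index ∘ proj₂) (shadow ∘ bk≢a)
          (collinear-baa⇒≡ ∘ shadow-≡⇒collinear _ _) avoids

      off-code : ∀ {jc jo} → jc ≢ jo → b jc ∈ l → b jo ∈ l →
        Σ (OffL → Fin (q ∸ s)) λ f → ∀ x y → f x ≡ f y → Collinear (b jc) (b (proj₁ x)) (b (proj₁ y))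
      off-code {jc} {jo} jc≢jo c∈l o∈l =
        proj₁ shrunk , λ x y → shadow-≡⇒collinear _ _ ∘ proj₂ shrunk x y
        where
        c≢o : b jc ≢ b jo
        c≢o = jc≢jo ∘ b-injective
        o≢z : b jo ≢ b k
        o≢z = ∈∉⇒≢ o∈l bk∉l
        c∉m : ¬ b jc ∈ line o≢z
        c∉m c∈m = bk∉l (collinear⇒∈ c≢o c∈l o∈l (line o≢z , c∈m , ∈-lineˡ o≢z , ∈-lineʳ o≢z))
        open Projection c∉m
        c≢a : ∀ i → b jc ≢ a i
        c≢a i = ≢-sym (a≢b i jc)
        avoided : Fin (suc s) → Fin (suc q)
        avoided zero = shadow c≢o
        avoided (suc i) = shadow (c≢a i)
        avoided-injective : Injective _≡_ _≡_ avoided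
        avoided-injective {zero} {zero} _ = refl
        avoided-injective {zero} {suc i} e =
          ⊥-elim (jc≢jo (collinear-bba⇒≡ (shadow-≡⇒collinear _ _ e)))
        avoided-injective {suc i} {zero} e =
          ⊥-elim (jc≢jo (collinear-bba⇒≡ (collinear-swap (shadow-≡⇒collinear _ _ e))))
        avoided-injective {suc i} {suc i′} e =
          cong suc (collinear-baa⇒≡ (shadow-≡⇒collinear _ _ e))
        c≢off : ∀ (x : OffL) → b jc ≢ b (proj₁ x)
        c≢off (_ , bj∉l) = ∈∉⇒≢ c∈l bj∉l
        avoids : ∀ (x : OffL) i → shadow (c≢off x) ≢ avoided i
        avoids (j , bj∉l) zero e =
          bj∉l (collinear⇒∈ c≢o c∈l o∈l (collinear-swap (shadow-≡⇒collinear _ _ e)))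
        avoids (j , bj∉l) (suc i) e =
          bj∉l (subst (λ j → b j ∈ l) (collinear-bba⇒≡ (shadow-≡⇒collinear _ _ e)) c∈l)
        shrunk : Σ (OffL → Fin (q ∸ s)) λ f → ∀ x y → f x ≡ f y → shadow (c≢off x) ≡ shadow (c≢off y)
        shrunk = shrink-avoiding (suc q) (suc s) (shadow ∘ c≢off) avoided avoided-injective avoids

      off-pair-code : Σ (OffL → Fin ((q ∸ s) * (q ∸ s))) λ f → ∀ x y → f x ≡ f y → proj₁ x ≡ proj₁ y
      off-pair-code = code , code-injective
        where
        from₀ : Σ (OffL → Fin (q ∸ s)) λ f → ∀ x y → f x ≡ f y → Collinear (b j₀) (b (proj₁ x)) (b (proj₁ y))
        from₀ = off-code j₀≢j₁ b₀∈l b₁∈l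
        from₁ : Σ (OffL → Fin (q ∸ s)) λ f → ∀ x y → f x ≡ f y → Collinear (b j₁) (b (proj₁ x)) (b (proj₁ y))
        from₁ = off-code (≢-sym j₀≢j₁) b₁∈l b₀∈l
        code : OffL → Fin ((q ∸ s) * (q ∸ s))
        code x = combine (proj₁ from₀ x) (proj₁ from₁ x)
        code-injective : ∀ x y → code x ≡ code y → proj₁ x ≡ proj₁ y
        code-injective x y e = off-l-separated (proj₁ x Fin.≟ proj₁ y) (proj₂ x)
          (proj₂ from₀ x y (proj₁ codes)) (proj₂ from₁ x y (proj₂ codes))
          where
          codes : proj₁ from₀ x ≡ proj₁ from₀ y × proj₁ from₁ x ≡ proj₁ from₁ y
          codes = Fin.combine-injective (proj₁ from₀ x) (proj₁ from₁ x) (proj₁ from₀ y) (proj₁ from₁ y) e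

      off-l⇒t≤ : t ≤ suc q ∸ s + (q ∸ s) * (q ∸ s)
      off-l⇒t≤ = injective-⊎⇒≤ (λ j → code j (dec j)) (code-injective _ _)
        where
        code : ∀ j → Dec (b j ∈ l) → Fin (suc q ∸ s) ⊎ Fin ((q ∸ s) * (q ∸ s))
        code j (yes bj∈l) = inj₁ (proj₁ on-code (j , bj∈l))
        code j (no bj∉l) = inj₂ (proj₁ off-pair-code (j , bj∉l))
        code-injective : ∀ {j j′} d d′ → code j d ≡ code j′ d′ → j ≡ j′
        code-injective (yes _) (yes _) e = proj₂ on-code _ _ (inj₁-injective e)
        code-injective (no _) (no _) e = proj₂ off-pair-code _ _ (inj₂-injective e)

    all-on-l-or-t≤ : (∀ j → Dec (b j ∈ l)) →
      (∀ j → b j ∈ l) ⊎ t ≤ suc q ∸ s + (q ∸ s) * (q ∸ s)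
    all-on-l-or-t≤ dec with Fin.all? dec
    ... | yes on = inj₁ on
    ... | no ¬on = inj₂ (off-l⇒t≤ (proj₂ (Fin.¬∀⟶∃¬ t _ dec ¬on)) dec)

corollary4p5 : (π : ProjectivePlane) (q : ℕ) → HasOrder π q →
    (n : ℕ) → n > 1 → (s t : ℕ) → s ≥ q ∸ n → t > n * n + n + 1 →
    (e : Embedding π s t) →
    Σ (Line π) λ l → ∀ (j : Fin t) → _I_ π (Embedding.φ e (inj₂ j)) l
corollary4p5 π q order n _ s t q∸n≤s n²+n+1<t e = l , all-on-l
  where
  open Geometry π q order using (_∈_)
  open Configuration order e
  pair : Σ (Fin t) λ j₀ → Σ (Fin t) λ j₁ → j₀ ≢ j₁
  pair = distinct-pair (ℕ.≤-trans (s≤s (ℕ.m≤n+m 1 (n * n + n))) n²+n+1<t)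
  open Through (proj₂ (proj₂ pair))
  too-many : ¬ t ≤ suc q ∸ s + (q ∸ s) * (q ∸ s)
  too-many t≤ = ℕ.<⇒≱ n²+n+1<t (ℕ.≤-trans t≤ (count-bound q n s q∸n≤s))
  -- Incidence with l is decided by projecting from a left point; when s = 0 the
  -- hypotheses are contradictory, which only needs decidability up to double negation.
  s≢0 : s ≢ 0
  s≢0 s≡0 = ¬¬-decidable t (λ j → b j ∈ l) λ dec →
    [ too-many ∘ (λ on → ℕ.≤-trans (all-on-l⇒t≤ on) suc-q≤) , too-many ]′ (all-on-l-or-t≤ dec)
    where
    suc-q≤ : suc q ≤ suc q ∸ s + (q ∸ s) * (q ∸ s)
    suc-q≤ = subst (λ s → suc q ≤ suc q ∸ s + (q ∸ s) * (q ∸ s)) (sym s≡0) (ℕ.m≤m+n (suc q) (q * q))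
  all-on-l : ∀ j → b j ∈ l
  all-on-l = [ id , ⊥-elim ∘ too-many ]′ (all-on-l-or-t≤ (∈l? (fromℕ< (ℕ.n≢0⇒n>0 s≢0))))
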